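{- For every graph $G$, $\widehat{\Theta}(G)=\rho_T(G)=\rho_{\widehat{T}}(\overline{G})=\Theta(\overline{G})$, where $\overline{G}$ is the complement of $G$.
   Context: Graphs are finite and simple. $G=(V,E)$ is a threshold graph if there are real weights $w(v)$ and a real $t$ with $w(x)+w(y)\ge t$ iff $xy\in E$ for distinct $x,y$. $\Theta(G)$ (threshold dimension) is the minimum number of threshold subgraphs of $G$ whose union is $G$. $\widehat{\Theta}(G)$ is the minimum $k$ such that there are threshold graphs $G_1,\dots,G_k$ on vertex set $V$ with $E=\bigcap_i E(G_i)$. For vectors of length $k$, $u\odot v=\min_i(u_i+v_i)$ and $u\,\widehat{\odot}\,v=\max_i(u_i+v_i)$. $\rho_T(G)$ (resp. $\rho_{\widehat{T}}(G)$) is the minimum $k$ such that there is $f:V\to(\mathbb{R}\cup\{\infty\})^k$ (resp. $(\mathbb{R}\cup\{ -\infty\})^k$) and a threshold $t>0$ with, for all distinct $x,y$, $xy\in E$ iff $f(x)\odot f(y)\ge t$ (resp. $f(x)\,\widehat{\odot}\,f(y)\ge t$).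
   Formalization: The weights and thresholds of threshold graphs and of $\rho_T$, $\rho_{\widehat{T}}$ are rational rather than real, and the vector entries lie in ℚ∪{∞} and ℚ∪{−∞} instead of ℝ∪{∞} and ℝ∪{−∞}. -}

module Defs where

open import Data.Nat using (ℕ)
open import Data.Fin using (Fin; _≟_)
open import Data.Bool using (Bool; true; false; not; if_then_else_)
open import Data.Rational using (ℚ; _≤_; _<_; _+_; _⊓_; _⊔_; 0ℚ)
open import Data.Product using (Σ; _×_)
open import Data.Unit using (⊤)
open import Data.Empty using (⊥)
open import Data.Vec.Functional using (foldr)
open import Function.Bundles using (_⇔_)
open import Relation.Nullary using (yes; no; ¬_)
open import Relation.Binary.PropositionalEquality using (_≡_; _≢_; refl; sym)

record Graph (n : ℕ) : Set where
  field
    adj    : Fin n → Fin n → Bool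
    adj-sym : ∀ x y → adj x y ≡ adj y x
    adj-irrefl : ∀ x → adj x x ≡ false
open Graph public

Edge : ∀ {n} → Graph n → Fin n → Fin n → Set
Edge G x y = adj G x y ≡ true

complAdj : ∀ {n} → Graph n → Fin n → Fin n → Bool
complAdj G x y with x ≟ y
... | yes _ = false
... | no _ = not (adj G x y)

private
  complSym : ∀ {n} (G : Graph n) x y → complAdj G x y ≡ complAdj G y x
  complSym G x y with x ≟ y | y ≟ x
  ... | yes _ | yes _ = refl
  ... | yes p | no q = Data.Empty.⊥-elim (q (sym p))
    where import Data.Empty
  ... | no p | yes q = Data.Empty.⊥-elim (p (sym q))
    where import Data.Empty
  ... | no _ | no _ rewrite adj-sym G x y = refl

  complIrrefl : ∀ {n} (G : Graph n) x → complAdj G x x ≡ false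
  complIrrefl G x with x ≟ x
  ... | yes _ = refl
  ... | no p = Data.Empty.⊥-elim (p refl)
    where import Data.Empty

complement : ∀ {n} → Graph n → Graph n
complement G = record { adj = complAdj G ; adj-sym = complSym G ; adj-irrefl = complIrrefl G }

IsThreshold : ∀ {n} → Graph n → Set
IsThreshold {n} G =
  Σ (Fin n → ℚ) λ w → Σ ℚ λ t →
    ∀ x y → x ≢ y → (Edge G x y ⇔ (t ≤ w x + w y))

Subgraph : ∀ {n} → Graph n → Graph n → Set
Subgraph H G = ∀ x y → Edge H x y → Edge G x y

ThetaCover : ∀ {n} → Graph n → ℕ → Set
ThetaCover {n} G k =
  Σ (Fin k → Graph n) λ H →
    (∀ i → IsThreshold (H i)) × (∀ i → Subgraph (H i) G) ×
    (∀ x y → Edge G x y → Σ (Fin k) λ i → Edge (H i) x y)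

ThetaHatCover : ∀ {n} → Graph n → ℕ → Set
ThetaHatCover {n} G k =
  Σ (Fin k → Graph n) λ H →
    (∀ i → IsThreshold (H i)) ×
    (∀ x y → x ≢ y → (Edge G x y ⇔ (∀ i → Edge (H i) x y)))

data ℚ∞ : Set where
  fin : ℚ → ℚ∞
  ∞   : ℚ∞

_+∞_ : ℚ∞ → ℚ∞ → ℚ∞
fin a +∞ fin b = fin (a + b)
fin _ +∞ ∞ = ∞
∞ +∞ _ = ∞

min∞ : ℚ∞ → ℚ∞ → ℚ∞
min∞ (fin a) (fin b) = fin (a ⊓ b)
min∞ (fin a) ∞ = fin a
min∞ ∞ b = b

_≤∞_ : ℚ → ℚ∞ → Set
t ≤∞ fin a = t ≤ a
t ≤∞ ∞ = ⊤

_⊙_ : ∀ {k} → (Fin k → ℚ∞) → (Fin k → ℚ∞) → ℚ∞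
u ⊙ v = foldr min∞ ∞ (λ i → u i +∞ v i)

data ℚ-∞ : Set where
  fin : ℚ → ℚ-∞
  -∞  : ℚ-∞

_+-∞_ : ℚ-∞ → ℚ-∞ → ℚ-∞
fin a +-∞ fin b = fin (a + b)
fin _ +-∞ -∞ = -∞
-∞ +-∞ _ = -∞

max-∞ : ℚ-∞ → ℚ-∞ → ℚ-∞
max-∞ (fin a) (fin b) = fin (a ⊔ b)
max-∞ (fin a) -∞ = fin a
max-∞ -∞ b = b

_≤-∞_ : ℚ → ℚ-∞ → Set
t ≤-∞ fin a = t ≤ a
t ≤-∞ -∞ = ⊥

_⊙̂_ : ∀ {k} → (Fin k → ℚ-∞) → (Fin k → ℚ-∞) → ℚ-∞
u ⊙̂ v = foldr max-∞ -∞ (λ i → u i +-∞ v i)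

RhoT : ∀ {n} → Graph n → ℕ → Set
RhoT {n} G k =
  Σ (Fin n → Fin k → ℚ∞) λ f → Σ ℚ λ t → (0ℚ < t) ×
    (∀ x y → x ≢ y → (Edge G x y ⇔ (t ≤∞ (f x ⊙ f y))))

RhoTHat : ∀ {n} → Graph n → ℕ → Set
RhoTHat {n} G k =
  Σ (Fin n → Fin k → ℚ-∞) λ f → Σ ℚ λ t → (0ℚ < t) ×
    (∀ x y → x ≢ y → (Edge G x y ⇔ (t ≤-∞ (f x ⊙̂ f y))))

IsMin : (ℕ → Set) → ℕ → Set
IsMin P m = P m × (∀ k → P k → m Data.Nat.≤ k)
  where import Data.Nat

-- Complementing each graph of a family turns an intersection into a union of
-- complements, and the complement of a threshold graph is again threshold;
-- hence Θ̂(G) = Θ(Ḡ). A representation f : V → (ℚ ∪ {∞})ᵏ with threshold t is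
-- the same as k threshold graphs intersected, one per coordinate: an entry ∞
-- can be traded for a large finite weight, and conversely the weights of each
-- threshold graph can be shifted so that its threshold becomes 1. Dually ⊙̂
-- with entries −∞ describes unions, giving ρ_T̂(Ḡ) = Θ(Ḡ). The common minimum
-- exists constructively: Θ(Ḡ) ≤ n (stars cover Ḡ), and being threshold is
-- decidable because a threshold graph has a dominating or an isolated vertex.
module Submission where

open import Defs
open import Data.Nat as ℕ using (ℕ; zero; suc)
import Data.Nat.Properties as ℕP
open import Data.Nat.Induction using (<-wellFounded)
open import Data.Fin using (Fin; zero; suc; _≟_; toℕ; fromℕ; fromℕ<)
open import Data.Fin.Properties
  using (¬∀⟶∃¬; ¬∀⟶∃¬-smallest; all?; any?; toℕ-fromℕ; toℕ-fromℕ<; toℕ-inject)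
open import Data.Rational hiding (_≟_)
open import Data.Rational.Properties hiding (_≟_)
open import Data.Rational.Solver using (module +-*-Solver)
open import Algebra.Properties.Group +-0-group using (⁻¹-involutive)
open import Data.Bool using (Bool; true; false; _∧_)
import Data.Bool.Properties as Bool
open import Data.Product using (Σ; ∃; _×_; _,_; proj₁; proj₂; curry; uncurry)
open import Data.Sum using (_⊎_; inj₁; inj₂)
open import Data.Unit using (tt)
open import Data.Empty using (⊥-elim)
open import Data.List using (List; []; _∷_; length; filter; tabulate; cartesianProductWith; allFin)
open import Data.List.Properties using (filter-notAll)
open import Data.List.Relation.Unary.Any as Any using (here; there)
import Data.List.Relation.Unary.All as All
open import Data.List.Membership.Propositional using (_∈_; lose; find)
open import Data.List.Relation.Binary.Subset.Propositional using (_⊆_)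
open import Data.List.Membership.Propositional.Properties
  using (∈-tabulate⁺; ∈-filter⁺; ∈-filter⁻; ∈-cartesianProductWith⁺; ∈-allFin)
open import Relation.Binary.Bundles using (DecTotalOrder)
open import Data.List.Extrema (DecTotalOrder.totalOrder ≤-decTotalOrder)
  using ( argmin; argmax; max; ⊥≤max; xs≤max; argmin-all; argmax-all
        ; f[argmin]≤f[⊤]; f[argmin]≤f[xs]; f[⊥]≤f[argmax]; f[xs]≤f[argmax])
open import Data.Vec using (Vec; []; _∷_; lookup)
import Data.Vec as Vec
open import Data.Vec.Properties using (lookup∘tabulate)
open import Function using (_∘_)
open import Function.Bundles using (_⇔_; mk⇔; Equivalence)
import Function.Properties.Equivalence as ⇔
open import Function.Related.Propositional using (module EquationalReasoning; equivalence)
open import Function.Related.TypeIsomorphisms using (¬-cong-⇔)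
open import Induction.WellFounded using (Acc; acc)
open import Relation.Nullary using (¬_; Dec; yes; no)
open import Relation.Nullary.Decidable
  using (decidable-stable; from-no; map′; ¬?; _→-dec_; _⊎-dec_; _×-dec_)
open import Relation.Binary.PropositionalEquality

open EquationalReasoning {k = equivalence}
open +-*-Solver using (solve; _:+_; _:*_; _:-_; con; _:=_)

<⇒≱ : ∀ {p q} → p < q → ¬ q ≤ p
<⇒≱ p<q q≤p = <-irrefl refl (<-≤-trans p<q q≤p)

p≤p+q : ∀ p {q} → 0ℚ ≤ q → p ≤ p + q
p≤p+q p {q} 0≤q = subst (_≤ p + q) (+-identityʳ p) (+-monoʳ-≤ p 0≤q)

-p≤q⇒0≤q+p : ∀ {p q} → - p ≤ q → 0ℚ ≤ q + p
-p≤q⇒0≤q+p {p} {q} -p≤q = subst (_≤ q + p) (+-inverseˡ p) (+-monoˡ-≤ p -p≤q)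

p≤q⇒p-q≤0 : ∀ {p q} → p ≤ q → p - q ≤ 0ℚ
p≤q⇒p-q≤0 {p} {q} p≤q = subst (p - q ≤_) (+-inverseʳ q) (+-monoˡ-≤ (- q) p≤q)

p-1<p : ∀ p → p - 1ℚ < p
p-1<p p = subst (p - 1ℚ <_) (+-identityʳ p) (+-monoʳ-< p (negative⁻¹ (- 1ℚ)))

+-cancelʳ-≤ : ∀ r {p q} → p + r ≤ q + r → p ≤ q
+-cancelʳ-≤ r {p} {q} p+r≤q+r = subst₂ _≤_ (cancel p) (cancel q) (+-monoˡ-≤ (- r) p+r≤q+r)
  where
  cancel : ∀ x → x + r - r ≡ x
  cancel x = trans (+-assoc x r (- r)) (trans (cong (x +_) (+-inverseʳ r)) (+-identityʳ x))

neg-≤⇔ : ∀ {p q} → p ≤ q ⇔ - q ≤ - p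
neg-≤⇔ {p} {q} = mk⇔ neg-antimono-≤ (λ h → subst₂ _≤_ (⁻¹-involutive p) (⁻¹-involutive q) (neg-antimono-≤ h))

0<1 : 0ℚ < 1ℚ
0<1 = positive⁻¹ 1ℚ

upperBound : ∀ {n} (g : Fin n → ℚ) → Σ ℚ λ M → 0ℚ ≤ M × (∀ x → g x ≤ M)
upperBound g = max 0ℚ (tabulate g) , ⊥≤max 0ℚ (tabulate g)
              , λ x → All.lookup (xs≤max 0ℚ (tabulate g)) (∈-tabulate⁺ x)

largestBelow : (xs : List ℚ) (t : ℚ) → Σ ℚ λ M → M < t × (∀ {s} → s ∈ xs → s < t → s ≤ M)
largestBelow xs t = max (t - 1ℚ) below
                  , argmax-all (λ s → s) (p-1<p t)
                               (All.tabulate λ s∈below → proj₂ (∈-filter⁻ (_<? t) {xs = xs} s∈below))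
                  , λ s∈xs s<t → All.lookup (xs≤max (t - 1ℚ) below) (∈-filter⁺ (_<? t) s∈xs s<t)
  where
  below : List ℚ
  below = filter (_<? t) xs

normalised : ∀ {n} → (Fin n → ℚ) → ℚ → Fin n → ℚ
normalised w t x = w x + ½ * (1ℚ - t)

normalised-≤ : ∀ {n} (w : Fin n → ℚ) t x y →
               (t ≤ w x + w y) ⇔ (1ℚ ≤ normalised w t x + normalised w t y)
normalised-≤ w t x y = mk⇔
  (λ h → subst₂ _≤_ (threshold t) (weights (w x) (w y) c) (+-monoˡ-≤ (c + c) h))
  (λ h → +-cancelʳ-≤ (c + c) (subst₂ _≤_ (sym (threshold t)) (sym (weights (w x) (w y) c)) h))
  where
  c = ½ * (1ℚ - t)
  threshold : ∀ t → t + (½ * (1ℚ - t) + ½ * (1ℚ - t)) ≡ 1ℚ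
  threshold = solve 1 (λ t → t :+ (con ½ :* (con 1ℚ :- t) :+ con ½ :* (con 1ℚ :- t)) := con 1ℚ) refl
  weights : ∀ a b c → (a + b) + (c + c) ≡ (a + c) + (b + c)
  weights = solve 3 (λ a b c → (a :+ b) :+ (c :+ c) := (a :+ c) :+ (b :+ c)) refl

≤∞-min∞ : ∀ t a b → (t ≤∞ min∞ a b) ⇔ (t ≤∞ a × t ≤∞ b)
≤∞-min∞ t (fin a) (fin b) = mk⇔ (λ h → p≤q⊓r⇒p≤q a b h , p≤q⊓r⇒p≤r a b h) (λ (h₁ , h₂) → ⊓-glb h₁ h₂)
≤∞-min∞ t (fin a) ∞       = mk⇔ (λ h → h , tt) proj₁
≤∞-min∞ t ∞       b       = mk⇔ (λ h → tt , h) proj₂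

≤∞-⊙ : ∀ {k} t (u v : Fin k → ℚ∞) → (t ≤∞ (u ⊙ v)) ⇔ (∀ i → t ≤∞ (u i +∞ v i))
≤∞-⊙ {zero}  t u v = mk⇔ (λ _ ()) (λ _ → tt)
≤∞-⊙ {suc k} t u v = mk⇔
  (λ h → λ { zero → proj₁ (to head∧tail h) ; (suc i) → to tail (proj₂ (to head∧tail h)) i })
  (λ h → from head∧tail (h zero , from tail (h ∘ suc)))
  where
  open Equivalence
  head∧tail = ≤∞-min∞ t (u zero +∞ v zero) ((u ∘ suc) ⊙ (v ∘ suc))
  tail = ≤∞-⊙ t (u ∘ suc) (v ∘ suc)

≤-∞-max-∞ : ∀ t a b → (t ≤-∞ max-∞ a b) ⇔ (t ≤-∞ a ⊎ t ≤-∞ b)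
≤-∞-max-∞ t (fin a) (fin b) = mk⇔ split (λ { (inj₁ h) → p≤q⇒p≤q⊔r b h ; (inj₂ h) → p≤q⇒p≤r⊔q a h })
  where
  split : t ≤ a ⊔ b → t ≤ a ⊎ t ≤ b
  split h with ⊔-sel a b
  ... | inj₁ a⊔b≡a = inj₁ (subst (t ≤_) a⊔b≡a h)
  ... | inj₂ a⊔b≡b = inj₂ (subst (t ≤_) a⊔b≡b h)
≤-∞-max-∞ t (fin a) -∞ = mk⇔ inj₁ (λ { (inj₁ h) → h ; (inj₂ ()) })
≤-∞-max-∞ t -∞      b  = mk⇔ inj₂ (λ { (inj₁ ()) ; (inj₂ h) → h })

≤-∞-⊙̂ : ∀ {k} t (u v : Fin k → ℚ-∞) → (t ≤-∞ (u ⊙̂ v)) ⇔ (∃ λ i → t ≤-∞ (u i +-∞ v i))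
≤-∞-⊙̂ {zero}  t u v = mk⇔ (λ ()) (λ ())
≤-∞-⊙̂ {suc k} t u v = mk⇔
  (λ h → case (to head∨tail h))
  (λ { (zero , h) → from head∨tail (inj₁ h) ; (suc i , h) → from head∨tail (inj₂ (from tail (i , h))) })
  where
  open Equivalence
  head∨tail = ≤-∞-max-∞ t (u zero +-∞ v zero) ((u ∘ suc) ⊙̂ (v ∘ suc))
  tail = ≤-∞-⊙̂ t (u ∘ suc) (v ∘ suc)
  case : t ≤-∞ (u zero +-∞ v zero) ⊎ t ≤-∞ ((u ∘ suc) ⊙̂ (v ∘ suc)) → ∃ λ i → t ≤-∞ (u i +-∞ v i)
  case (inj₁ h) = zero , h
  case (inj₂ h) = let (i , h′) = to tail h in suc i , h′

-- ∞ is replaced by t + M, where M ≥ 0 bounds the negated finite entries.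
finitise∞ : ∀ {n} (a : Fin n → ℚ∞) {t} → 0ℚ < t →
            Σ (Fin n → ℚ) λ w → ∀ x y → (t ≤∞ (a x +∞ a y)) ⇔ (t ≤ w x + w y)
finitise∞ {n} a {t} 0<t = w , λ x y → pair (a x) (a y) (bound x) (bound y)
  where
  negFinite : ℚ∞ → ℚ
  negFinite (fin p) = - p
  negFinite ∞       = 0ℚ
  M = proj₁ (upperBound (negFinite ∘ a))
  0≤M = proj₁ (proj₂ (upperBound (negFinite ∘ a)))
  bound = proj₂ (proj₂ (upperBound (negFinite ∘ a)))
  L = t + M
  weight : ℚ∞ → ℚ
  weight (fin p) = p
  weight ∞       = L
  w : Fin n → ℚ
  w = weight ∘ a
  t≤p+L : ∀ {p} → - p ≤ M → t ≤ p + L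
  t≤p+L {p} -p≤M = subst (t ≤_) (trans (sym (+-assoc t M p)) (+-comm L p)) (p≤p+q t (-p≤q⇒0≤q+p -p≤M))
  t≤L : t ≤ L
  t≤L = p≤p+q t 0≤M
  t≤L+L : t ≤ L + L
  t≤L+L = ≤-trans t≤L (p≤p+q L (≤-trans (<⇒≤ 0<t) t≤L))
  pair : ∀ p q → negFinite p ≤ M → negFinite q ≤ M → (t ≤∞ (p +∞ q)) ⇔ (t ≤ weight p + weight q)
  pair (fin p) (fin q) _  _  = mk⇔ (λ h → h) (λ h → h)
  pair (fin p) ∞       bp _  = mk⇔ (λ _ → t≤p+L bp) (λ _ → tt)
  pair ∞       (fin q) _  bq = mk⇔ (λ _ → subst (t ≤_) (+-comm q L) (t≤p+L bq)) (λ _ → tt)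
  pair ∞       ∞       _  _  = mk⇔ (λ _ → t≤L+L) (λ _ → tt)

finitise-∞ : ∀ {n} (a : Fin n → ℚ-∞) {t} → 0ℚ < t →
             Σ (Fin n → ℚ) λ w → ∀ x y → (t ≤-∞ (a x +-∞ a y)) ⇔ (t ≤ w x + w y)
finitise-∞ {n} a {t} 0<t = w , λ x y → pair (a x) (a y) (bound x) (bound y)
  where
  finite : ℚ-∞ → ℚ
  finite (fin p) = p
  finite -∞      = 0ℚ
  M = proj₁ (upperBound (finite ∘ a))
  0≤M = proj₁ (proj₂ (upperBound (finite ∘ a)))
  bound = proj₂ (proj₂ (upperBound (finite ∘ a)))
  weight : ℚ-∞ → ℚ
  weight (fin p) = p
  weight -∞      = - M
  w : Fin n → ℚ
  w = weight ∘ a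
  p-M<t : ∀ {p} → p ≤ M → ¬ t ≤ p - M
  p-M<t p≤M = <⇒≱ (≤-<-trans (p≤q⇒p-q≤0 p≤M) 0<t)
  -M≤M : - M ≤ M
  -M≤M = ≤-trans (neg-antimono-≤ 0≤M) 0≤M
  pair : ∀ p q → finite p ≤ M → finite q ≤ M → (t ≤-∞ (p +-∞ q)) ⇔ (t ≤ weight p + weight q)
  pair (fin p) (fin q) _  _  = mk⇔ (λ h → h) (λ h → h)
  pair (fin p) -∞      bp _  = mk⇔ (λ ()) (λ h → ⊥-elim (p-M<t bp h))
  pair -∞      (fin q) _  bq = mk⇔ (λ ()) (λ h → ⊥-elim (p-M<t bq (subst (t ≤_) (+-comm (- M) q) h)))
  pair -∞      -∞      _  _  = mk⇔ (λ ()) (λ h → ⊥-elim (p-M<t -M≤M h))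

module _ {n : ℕ} where

  edge⇒≢ : (H : Graph n) {x y : Fin n} → Edge H x y → x ≢ y
  edge⇒≢ H {x} e refl with () ← trans (sym e) (adj-irrefl H x)

  edge-sym : (H : Graph n) {x y : Fin n} → Edge H x y → Edge H y x
  edge-sym H {x} {y} e = trans (adj-sym H y x) e

  edge? : (H : Graph n) (x y : Fin n) → Dec (Edge H x y)
  edge? H x y = adj H x y Bool.≟ true

  complement-edge : (H : Graph n) {x y : Fin n} → x ≢ y → Edge (complement H) x y ⇔ (¬ Edge H x y)
  complement-edge H {x} {y} x≢y with x ≟ y
  ... | yes x≡y = ⊥-elim (x≢y x≡y)
  ... | no _ with adj H x y
  ...   | true  = mk⇔ (λ ()) (λ ¬e → ⊥-elim (¬e refl))
  ...   | false = mk⇔ (λ _ ()) (λ _ → refl)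

  edge⇔¬complement-edge : (H : Graph n) {x y : Fin n} → x ≢ y → Edge H x y ⇔ (¬ Edge (complement H) x y)
  edge⇔¬complement-edge H {x} {y} x≢y = mk⇔
    (λ e ē → Equivalence.to (complement-edge H x≢y) ē e)
    (λ ¬ē → decidable-stable (edge? H x y) (¬ē ∘ Equivalence.from (complement-edge H x≢y)))

  Represents : Graph n → (Fin n → ℚ) → ℚ → Set
  Represents G w t = ∀ x y → x ≢ y → Edge G x y ⇔ (t ≤ w x + w y)

  thresholdAdj : (Fin n → ℚ) → ℚ → Fin n → Fin n → Bool
  thresholdAdj w t x y with x ≟ y
  ... | yes _ = false
  ... | no _  = t ≤ᵇ w x + w y

  thresholdGraph : (Fin n → ℚ) → ℚ → Graph n
  thresholdGraph w t = record { adj = thresholdAdj w t ; adj-sym = symmetric ; adj-irrefl = irreflexive }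
    where
    symmetric : ∀ x y → thresholdAdj w t x y ≡ thresholdAdj w t y x
    symmetric x y with x ≟ y | y ≟ x
    ... | yes _   | yes _   = refl
    ... | yes x≡y | no y≢x  = ⊥-elim (y≢x (sym x≡y))
    ... | no x≢y  | yes y≡x = ⊥-elim (x≢y (sym y≡x))
    ... | no _    | no _    = cong (t ≤ᵇ_) (+-comm (w x) (w y))
    irreflexive : ∀ x → thresholdAdj w t x x ≡ false
    irreflexive x with x ≟ x
    ... | yes _   = refl
    ... | no x≢x  = ⊥-elim (x≢x refl)

  thresholdGraph-represents : ∀ w t → Represents (thresholdGraph w t) w t
  thresholdGraph-represents w t x y x≢y with x ≟ y
  ... | yes x≡y = ⊥-elim (x≢y x≡y)
  ... | no _  = ⇔.trans (⇔.sym Bool.T-≡) (mk⇔ ≤ᵇ⇒≤ ≤⇒≤ᵇ)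

  thresholdGraph-isThreshold : ∀ w t → IsThreshold (thresholdGraph w t)
  thresholdGraph-isThreshold w t = w , t , thresholdGraph-represents w t

  normalise : (G : Graph n) → IsThreshold G → Σ (Fin n → ℚ) λ w → Represents G w 1ℚ
  normalise G (w , t , rep) = normalised w t , λ x y x≢y → ⇔.trans (rep x y x≢y) (normalised-≤ w t x y)

  -- The non-edges of a threshold graph are the pairs whose weight sum is at
  -- most the largest such sum M < t, so negating all weights gives the complement.
  complement-isThreshold : (H : Graph n) → IsThreshold H → IsThreshold (complement H)
  complement-isThreshold H (w , t , rep) = (λ x → - w x) , - M , represents
    where
    sums = cartesianProductWith (λ x y → w x + w y) (allFin n) (allFin n)
    M = proj₁ (largestBelow sums t)
    M<t = proj₁ (proj₂ (largestBelow sums t))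
    below = proj₂ (proj₂ (largestBelow sums t))
    nonEdge⇔≤M : ∀ x y → x ≢ y → (¬ Edge H x y) ⇔ (w x + w y ≤ M)
    nonEdge⇔≤M x y x≢y = mk⇔
      (λ ¬e → below (∈-cartesianProductWith⁺ _ (∈-allFin x) (∈-allFin y))
                    (≰⇒> (¬e ∘ Equivalence.from (rep x y x≢y))))
      (λ s≤M e → <⇒≱ (≤-<-trans s≤M M<t) (Equivalence.to (rep x y x≢y) e))
    represents : Represents (complement H) (λ x → - w x) (- M)
    represents x y x≢y = begin
      Edge (complement H) x y   ∼⟨ complement-edge H x≢y ⟩
      (¬ Edge H x y)            ∼⟨ nonEdge⇔≤M x y x≢y ⟩
      (w x + w y ≤ M)           ∼⟨ neg-≤⇔ ⟩
      (- M ≤ - (w x + w y))     ≡⟨ cong (- M ≤_) (neg-distrib-+ (w x) (w y)) ⟩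
      (- M ≤ - w x + - w y)     ∎

Π-cong-⇔ : ∀ {k} {P Q : Fin k → Set} → (∀ i → P i ⇔ Q i) → (∀ i → P i) ⇔ (∀ i → Q i)
Π-cong-⇔ P⇔Q = mk⇔ (λ p i → Equivalence.to (P⇔Q i) (p i)) (λ q i → Equivalence.from (P⇔Q i) (q i))

∃-cong-⇔ : ∀ {k} {P Q : Fin k → Set} → (∀ i → P i ⇔ Q i) → (∃ P) ⇔ (∃ Q)
∃-cong-⇔ P⇔Q = mk⇔ (λ (i , p) → i , Equivalence.to (P⇔Q i) p) (λ (i , q) → i , Equivalence.from (P⇔Q i) q)

¬Π⇔∃¬ : ∀ {k} {P : Fin k → Set} → (∀ i → Dec (P i)) → (¬ (∀ i → P i)) ⇔ (∃ λ i → ¬ P i)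
¬Π⇔∃¬ {k} {P} P? = mk⇔ (¬∀⟶∃¬ k P P?) (λ (i , ¬p) p → ¬p (p i))

IsIntersection : ∀ {n k} → Graph n → (Fin k → Graph n) → Set
IsIntersection G H = ∀ x y → x ≢ y → Edge G x y ⇔ (∀ i → Edge (H i) x y)

IsUnion : ∀ {n k} → Graph n → (Fin k → Graph n) → Set
IsUnion G H = ∀ x y → x ≢ y → Edge G x y ⇔ (∃ λ i → Edge (H i) x y)

UnionCover : ∀ {n} → Graph n → ℕ → Set
UnionCover {n} G k = Σ (Fin k → Graph n) λ H → (∀ i → IsThreshold (H i)) × IsUnion G H

module _ {n : ℕ} {k : ℕ} where

  thetaCover⇔unionCover : (G : Graph n) → ThetaCover G k ⇔ UnionCover G k
  thetaCover⇔unionCover G = mk⇔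
    (λ (H , thr , sub , cov) → H , thr , λ x y _ → mk⇔ (cov x y) (λ (i , e) → sub i x y e))
    (λ (H , thr , union) → H , thr
      , (λ i x y e → Equivalence.from (union x y (edge⇒≢ (H i) e)) (i , e))
      , (λ x y e → Equivalence.to (union x y (edge⇒≢ G e)) e))

  intersection⇒complement-union : ∀ {G : Graph n} {H : Fin k → Graph n} →
    IsIntersection G H → IsUnion (complement G) (complement ∘ H)
  intersection⇒complement-union {G} {H} intersection x y x≢y = begin
    Edge (complement G) x y                ∼⟨ complement-edge G x≢y ⟩
    (¬ Edge G x y)                         ∼⟨ ¬-cong-⇔ (intersection x y x≢y) ⟩
    (¬ (∀ i → Edge (H i) x y))             ∼⟨ ¬Π⇔∃¬ (λ i → edge? (H i) x y) ⟩
    (∃ λ i → ¬ Edge (H i) x y)             ∼⟨ ∃-cong-⇔ (λ i → ⇔.sym (complement-edge (H i) x≢y)) ⟩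
    (∃ λ i → Edge (complement (H i)) x y)  ∎

  complement-union⇒intersection : ∀ {G : Graph n} {H : Fin k → Graph n} →
    IsUnion (complement G) H → IsIntersection G (complement ∘ H)
  complement-union⇒intersection {G} {H} union x y x≢y = begin
    Edge G x y                             ∼⟨ edge⇔¬complement-edge G x≢y ⟩
    (¬ Edge (complement G) x y)            ∼⟨ ¬-cong-⇔ (union x y x≢y) ⟩
    (¬ (∃ λ i → Edge (H i) x y))           ∼⟨ mk⇔ curry uncurry ⟩
    (∀ i → ¬ Edge (H i) x y)               ∼⟨ Π-cong-⇔ (λ i → ⇔.sym (complement-edge (H i) x≢y)) ⟩
    (∀ i → Edge (complement (H i)) x y)    ∎

  thetaHat⇔unionCover-complement : (G : Graph n) → ThetaHatCover G k ⇔ UnionCover (complement G) k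
  thetaHat⇔unionCover-complement G = mk⇔
    (λ (H , thr , intersection) → complement ∘ H , (λ i → complement-isThreshold (H i) (thr i))
                                , intersection⇒complement-union intersection)
    (λ (H , thr , union) → complement ∘ H , (λ i → complement-isThreshold (H i) (thr i))
                         , complement-union⇒intersection union)

  rhoT⇔thetaHat : (G : Graph n) → RhoT G k ⇔ ThetaHatCover G k
  rhoT⇔thetaHat G = mk⇔ to from
    where
    to : RhoT G k → ThetaHatCover G k
    to (f , t , 0<t , rep) = H , (λ i → thresholdGraph-isThreshold (w i) t) , intersection
      where
      w : Fin k → Fin n → ℚ
      w i = proj₁ (finitise∞ (λ x → f x i) 0<t)
      H : Fin k → Graph n
      H i = thresholdGraph (w i) t
      intersection : IsIntersection G H
      intersection x y x≢y = begin
        Edge G x y                             ∼⟨ rep x y x≢y ⟩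
        (t ≤∞ (f x ⊙ f y))                     ∼⟨ ≤∞-⊙ t (f x) (f y) ⟩
        (∀ i → t ≤∞ (f x i +∞ f y i))          ∼⟨ Π-cong-⇔ (λ i → proj₂ (finitise∞ (λ z → f z i) 0<t) x y) ⟩
        (∀ i → t ≤ w i x + w i y)              ∼⟨ Π-cong-⇔ (λ i → ⇔.sym (thresholdGraph-represents (w i) t x y x≢y)) ⟩
        (∀ i → Edge (H i) x y)                 ∎
    from : ThetaHatCover G k → RhoT G k
    from (H , thr , intersection) = f , 1ℚ , 0<1 , λ x y x≢y → begin
        Edge G x y                             ∼⟨ intersection x y x≢y ⟩
        (∀ i → Edge (H i) x y)                 ∼⟨ Π-cong-⇔ (λ i → proj₂ (normalise (H i) (thr i)) x y x≢y) ⟩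
        (∀ i → 1ℚ ≤∞ (f x i +∞ f y i))         ∼⟨ ⇔.sym (≤∞-⊙ 1ℚ (f x) (f y)) ⟩
        (1ℚ ≤∞ (f x ⊙ f y))                    ∎
      where
      f : Fin n → Fin k → ℚ∞
      f x i = fin (proj₁ (normalise (H i) (thr i)) x)

  rhoTHat⇔unionCover : (G : Graph n) → RhoTHat G k ⇔ UnionCover G k
  rhoTHat⇔unionCover G = mk⇔ to from
    where
    to : RhoTHat G k → UnionCover G k
    to (f , t , 0<t , rep) = H , (λ i → thresholdGraph-isThreshold (w i) t) , union
      where
      w : Fin k → Fin n → ℚ
      w i = proj₁ (finitise-∞ (λ x → f x i) 0<t)
      H : Fin k → Graph n
      H i = thresholdGraph (w i) t
      union : IsUnion G H
      union x y x≢y = begin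
        Edge G x y                             ∼⟨ rep x y x≢y ⟩
        (t ≤-∞ (f x ⊙̂ f y))                    ∼⟨ ≤-∞-⊙̂ t (f x) (f y) ⟩
        (∃ λ i → t ≤-∞ (f x i +-∞ f y i))      ∼⟨ ∃-cong-⇔ (λ i → proj₂ (finitise-∞ (λ z → f z i) 0<t) x y) ⟩
        (∃ λ i → t ≤ w i x + w i y)            ∼⟨ ∃-cong-⇔ (λ i → ⇔.sym (thresholdGraph-represents (w i) t x y x≢y)) ⟩
        (∃ λ i → Edge (H i) x y)               ∎
    from : UnionCover G k → RhoTHat G k
    from (H , thr , union) = f , 1ℚ , 0<1 , λ x y x≢y → begin
        Edge G x y                             ∼⟨ union x y x≢y ⟩
        (∃ λ i → Edge (H i) x y)               ∼⟨ ∃-cong-⇔ (λ i → proj₂ (normalise (H i) (thr i)) x y x≢y) ⟩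
        (∃ λ i → 1ℚ ≤-∞ (f x i +-∞ f y i))     ∼⟨ ⇔.sym (≤-∞-⊙̂ 1ℚ (f x) (f y)) ⟩
        (1ℚ ≤-∞ (f x ⊙̂ f y))                   ∎
      where
      f : Fin n → Fin k → ℚ-∞
      f x i = fin (proj₁ (normalise (H i) (thr i)) x)

module ThresholdDecidable {n : ℕ} (G : Graph n) where

  RepresentsOn : List (Fin n) → (Fin n → ℚ) → ℚ → Set
  RepresentsOn S w t = ∀ {x y} → x ∈ S → y ∈ S → x ≢ y → Edge G x y ⇔ (t ≤ w x + w y)

  ThresholdOn : List (Fin n) → Set
  ThresholdOn S = Σ (Fin n → ℚ) λ w → Σ ℚ (RepresentsOn S w)

  Dominating : List (Fin n) → Fin n → Set
  Dominating S v = ∀ {y} → y ∈ S → y ≢ v → Edge G v y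

  Isolated : List (Fin n) → Fin n → Set
  Isolated S v = ∀ {y} → y ∈ S → y ≢ v → ¬ Edge G v y

  _─_ : List (Fin n) → Fin n → List (Fin n)
  S ─ v = filter (λ y → ¬? (y ≟ v)) S

  ∈-─ : ∀ {S v y} → y ∈ S → y ≢ v → y ∈ S ─ v
  ∈-─ = ∈-filter⁺ (λ y → ¬? (y ≟ _))

  ─-⊆ : ∀ {S v} → S ─ v ⊆ S
  ─-⊆ {v = v} = proj₁ ∘ ∈-filter⁻ (λ y → ¬? (y ≟ v))

  length-─ : ∀ {S v} → v ∈ S → length (S ─ v) ℕ.< length S
  length-─ {S} {v} v∈ = filter-notAll (λ y → ¬? (y ≟ v)) S (Any.map (λ v≡y y≢v → y≢v (sym v≡y)) v∈)

  thresholdOn-⊆ : ∀ {S S′} → S′ ⊆ S → ThresholdOn S → ThresholdOn S′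
  thresholdOn-⊆ S′⊆S (w , t , rep) = w , t , λ x∈ y∈ → rep (S′⊆S x∈) (S′⊆S y∈)

  -- A dominating vertex behaves as a vertex of weight ∞ in a threshold-1 representation.
  extend-dominating : ∀ {S v} → Dominating S v → ThresholdOn (S ─ v) → ThresholdOn S
  extend-dominating {S} {v} dominating (w′ , t′ , rep′) =
    w , 1ℚ , λ x∈ y∈ x≢y → ⇔.trans (withInfinity x∈ y∈ x≢y) (proj₂ (finitise∞ a 0<1) _ _)
    where
    u = normalised w′ t′
    a : Fin n → ℚ∞
    a x with x ≟ v
    ... | yes _ = ∞
    ... | no _  = fin (u x)
    w = proj₁ (finitise∞ a 0<1)
    withInfinity : ∀ {x y} → x ∈ S → y ∈ S → x ≢ y → Edge G x y ⇔ (1ℚ ≤∞ (a x +∞ a y))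
    withInfinity {x} {y} x∈ y∈ x≢y with x ≟ v | y ≟ v
    ... | yes refl | yes refl = ⊥-elim (x≢y refl)
    ... | yes refl | no y≢v   = mk⇔ (λ _ → tt) (λ _ → dominating y∈ y≢v)
    ... | no x≢v   | yes refl = mk⇔ (λ _ → tt) (λ _ → edge-sym G (dominating x∈ x≢v))
    ... | no x≢v   | no y≢v   =
      ⇔.trans (rep′ (∈-─ x∈ x≢v) (∈-─ y∈ y≢v) x≢y) (normalised-≤ w′ t′ x y)

  extend-isolated : ∀ {S v} → Isolated S v → ThresholdOn (S ─ v) → ThresholdOn S
  extend-isolated {S} {v} isolated (w′ , t′ , rep′) =
    w , 1ℚ , λ x∈ y∈ x≢y → ⇔.trans (withMinusInfinity x∈ y∈ x≢y) (proj₂ (finitise-∞ a 0<1) _ _)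
    where
    u = normalised w′ t′
    a : Fin n → ℚ-∞
    a x with x ≟ v
    ... | yes _ = -∞
    ... | no _  = fin (u x)
    w = proj₁ (finitise-∞ a 0<1)
    withMinusInfinity : ∀ {x y} → x ∈ S → y ∈ S → x ≢ y → Edge G x y ⇔ (1ℚ ≤-∞ (a x +-∞ a y))
    withMinusInfinity {x} {y} x∈ y∈ x≢y with x ≟ v | y ≟ v
    ... | yes refl | yes refl = ⊥-elim (x≢y refl)
    ... | yes refl | no y≢v   = mk⇔ (λ e → ⊥-elim (isolated y∈ y≢v e)) (λ ())
    ... | no x≢v   | yes refl = mk⇔ (λ e → ⊥-elim (isolated x∈ x≢v (edge-sym G e))) (λ ())
    ... | no x≢v   | no y≢v   =
      ⇔.trans (rep′ (∈-─ x∈ x≢v) (∈-─ y∈ y≢v) x≢y) (normalised-≤ w′ t′ x y)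

  extend : ∀ {S v} → Dominating S v ⊎ Isolated S v → ThresholdOn (S ─ v) → ThresholdOn S
  extend (inj₁ dominating) = extend-dominating dominating
  extend (inj₂ isolated)   = extend-isolated isolated

  module _ (w : Fin n → ℚ) (a : Fin n) (S : List (Fin n)) where

    argmin∈ : argmin w a S ∈ a ∷ S
    argmin∈ = argmin-all w (here refl) (All.tabulate there)

    argmax∈ : argmax w a S ∈ a ∷ S
    argmax∈ = argmax-all w (here refl) (All.tabulate there)

    argmin-≤ : ∀ {y} → y ∈ a ∷ S → w (argmin w a S) ≤ w y
    argmin-≤ (here refl) = f[argmin]≤f[⊤] {f = w} a S
    argmin-≤ (there y∈) = All.lookup (f[argmin]≤f[xs] {f = w} a S) y∈

    ≤-argmax : ∀ {y} → y ∈ a ∷ S → w y ≤ w (argmax w a S)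
    ≤-argmax (here refl) = f[⊥]≤f[argmax] {f = w} a S
    ≤-argmax (there y∈) = All.lookup (f[xs]≤f[argmax] {f = w} a S) y∈

  -- If the lightest and heaviest vertices are adjacent, the heaviest one is
  -- dominating; otherwise the lightest one is isolated.
  dominating⊎isolated : ∀ {a S} → ThresholdOn (a ∷ S) →
                        ∃ λ v → v ∈ a ∷ S × (Dominating (a ∷ S) v ⊎ Isolated (a ∷ S) v)
  dominating⊎isolated {a} {S} (w , t , rep) = decide (t ≤? w lightest + w heaviest)
    where
    lightest = argmin w a S
    heaviest = argmax w a S
    decide : Dec (t ≤ w lightest + w heaviest) →
             ∃ λ v → v ∈ a ∷ S × (Dominating (a ∷ S) v ⊎ Isolated (a ∷ S) v)
    decide (yes t≤) = heaviest , argmax∈ w a S , inj₁ λ {y} y∈ y≢v →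
      Equivalence.from (rep (argmax∈ w a S) y∈ (y≢v ∘ sym))
        (≤-trans t≤ (subst (w lightest + w heaviest ≤_) (+-comm (w y) (w heaviest))
                           (+-monoˡ-≤ (w heaviest) (argmin-≤ w a S y∈))))
    decide (no t≰) = lightest , argmin∈ w a S , inj₂ λ y∈ y≢u e →
      t≰ (≤-trans (Equivalence.to (rep (argmin∈ w a S) y∈ (y≢u ∘ sym)) e)
                  (+-monoʳ-≤ (w lightest) (≤-argmax w a S y∈)))

  dominating? : ∀ S v → Dec (Dominating S v)
  dominating? S v = map′ (λ all y∈ → All.lookup all y∈) All.tabulate
                         (All.all? (λ y → ¬? (y ≟ v) →-dec edge? G v y) S)

  isolated? : ∀ S v → Dec (Isolated S v)
  isolated? S v = map′ (λ all y∈ → All.lookup all y∈) All.tabulate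
                       (All.all? (λ y → ¬? (y ≟ v) →-dec ¬? (edge? G v y)) S)

  thresholdOn? : ∀ S → Acc ℕ._<_ (length S) → Dec (ThresholdOn S)
  thresholdOn? []      _             = yes ((λ _ → 0ℚ) , 0ℚ , λ ())
  thresholdOn? (a ∷ S) (acc smaller)
    with Any.any? (λ v → dominating? (a ∷ S) v ⊎-dec isolated? (a ∷ S) v) (a ∷ S)
  ... | no none = no λ th → let (v , v∈ , d) = dominating⊎isolated th in none (lose v∈ d)
  ... | yes some with find some
  ...   | v , v∈ , d with thresholdOn? ((a ∷ S) ─ v) (smaller (length-─ v∈))
  ...     | yes th = yes (extend d th)
  ...     | no ¬th = no (¬th ∘ thresholdOn-⊆ ─-⊆)

  isThreshold? : Dec (IsThreshold G)
  isThreshold? = map′ (λ (w , t , rep) → w , t , λ x y → rep (∈-allFin x) (∈-allFin y))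
                      (λ (w , t , rep) → w , t , λ {x} {y} _ _ → rep x y)
                      (thresholdOn? (allFin n) (<-wellFounded _))

open ThresholdDecidable using (isThreshold?)

Searchable : Set → Set₁
Searchable A = (P : A → Set) → (∀ a → Dec (P a)) → Dec (∃ P)

bool-searchable : Searchable Bool
bool-searchable P P? = map′ (λ { (inj₁ p) → true , p ; (inj₂ p) → false , p })
                            (λ { (true , p) → inj₁ p ; (false , p) → inj₂ p })
                            (P? true ⊎-dec P? false)

vec-searchable : ∀ {A} → Searchable A → ∀ m → Searchable (Vec A m)
vec-searchable search zero    P P? = map′ ([] ,_) (λ { ([] , p) → p }) (P? [])
vec-searchable search (suc m) P P? =
  map′ (λ (a , v , p) → a ∷ v , p) (λ { (a ∷ v , p) → a , v , p })
       (search (λ a → ∃ λ v → P (a ∷ v)) (λ a → vec-searchable search m (P ∘ (a ∷_)) (P? ∘ (a ∷_))))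

module _ {n : ℕ} where

  AdjacencyMatrix : Set
  AdjacencyMatrix = Vec (Vec Bool n) n

  fromMatrixAdj : AdjacencyMatrix → Fin n → Fin n → Bool
  fromMatrixAdj m x y with x ≟ y
  ... | yes _ = false
  ... | no _  = lookup (lookup m x) y ∧ lookup (lookup m y) x

  fromMatrix : AdjacencyMatrix → Graph n
  fromMatrix m = record { adj = fromMatrixAdj m ; adj-sym = symmetric ; adj-irrefl = irreflexive }
    where
    symmetric : ∀ x y → fromMatrixAdj m x y ≡ fromMatrixAdj m y x
    symmetric x y with x ≟ y | y ≟ x
    ... | yes _   | yes _   = refl
    ... | yes x≡y | no y≢x  = ⊥-elim (y≢x (sym x≡y))
    ... | no x≢y  | yes y≡x = ⊥-elim (x≢y (sym y≡x))
    ... | no _    | no _    = Bool.∧-comm (lookup (lookup m x) y) (lookup (lookup m y) x)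
    irreflexive : ∀ x → fromMatrixAdj m x x ≡ false
    irreflexive x with x ≟ x
    ... | yes _   = refl
    ... | no x≢x  = ⊥-elim (x≢x refl)

  toMatrix : Graph n → AdjacencyMatrix
  toMatrix H = Vec.tabulate λ x → Vec.tabulate λ y → adj H x y

  _≈ᴳ_ : Graph n → Graph n → Set
  H ≈ᴳ H′ = ∀ x y → adj H x y ≡ adj H′ x y

  fromMatrix-toMatrix : ∀ H → fromMatrix (toMatrix H) ≈ᴳ H
  fromMatrix-toMatrix H x y with x ≟ y
  ... | yes refl = sym (adj-irrefl H x)
  ... | no _ rewrite lookup∘tabulate (λ x → Vec.tabulate λ y → adj H x y) x
                   | lookup∘tabulate (λ x → Vec.tabulate λ y → adj H x y) y
                   | lookup∘tabulate (adj H x) y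
                   | lookup∘tabulate (adj H y) x
                   | adj-sym H y x = Bool.∧-idem (adj H x y)

  isThreshold-resp : ∀ {H H′} → H ≈ᴳ H′ → IsThreshold H → IsThreshold H′
  isThreshold-resp H≈H′ (w , t , rep) = w , t , λ x y x≢y →
    ⇔.trans (mk⇔ (trans (H≈H′ x y)) (trans (sym (H≈H′ x y)))) (rep x y x≢y)

module _ {n k : ℕ} where

  IsThresholdCover : Graph n → (Fin k → Graph n) → Set
  IsThresholdCover G H = (∀ i → IsThreshold (H i)) × (∀ i → Subgraph (H i) G) ×
                         (∀ x y → Edge G x y → ∃ λ i → Edge (H i) x y)

  isThresholdCover? : ∀ G H → Dec (IsThresholdCover G H)
  isThresholdCover? G H =
    all? (λ i → isThreshold? (H i))
    ×-dec all? (λ i → all? λ x → all? λ y → edge? (H i) x y →-dec edge? G x y)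
    ×-dec all? (λ x → all? λ y → edge? G x y →-dec any? λ i → edge? (H i) x y)

  isThresholdCover-resp : ∀ G H H′ → (∀ i → H i ≈ᴳ H′ i) → IsThresholdCover G H → IsThresholdCover G H′
  isThresholdCover-resp G H H′ H≈H′ (thr , sub , cov) =
      (λ i → isThreshold-resp {H = H i} {H′ = H′ i} (H≈H′ i) (thr i))
    , (λ i x y e → sub i x y (trans (H≈H′ i x y) e))
    , (λ x y e → let (i , e′) = cov x y e in i , trans (sym (H≈H′ i x y)) e′)

  thetaCover? : (G : Graph n) → Dec (ThetaCover G k)
  thetaCover? G =
    map′ (λ (ms , cover) → decode ms , cover)
         (λ (H , cover) → encode H , isThresholdCover-resp G H (decode (encode H)) (decode-encode H) cover)
         (matrices (λ ms → IsThresholdCover G (decode ms)) (λ ms → isThresholdCover? G (decode ms)))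
    where
    matrices : Searchable (Vec AdjacencyMatrix k)
    matrices = vec-searchable (vec-searchable (vec-searchable bool-searchable n) n) k
    decode : Vec AdjacencyMatrix k → Fin k → Graph n
    decode ms i = fromMatrix (lookup ms i)
    encode : (Fin k → Graph n) → Vec AdjacencyMatrix k
    encode H = Vec.tabulate (toMatrix ∘ H)
    decode-encode : ∀ H i → H i ≈ᴳ decode (encode H) i
    decode-encode H i x y =
      sym (trans (cong (λ m → adj (fromMatrix m) x y) (lookup∘tabulate (toMatrix ∘ H) i))
                 (fromMatrix-toMatrix (H i) x y))

module Stars {n : ℕ} (G : Graph n) where

  starWeight : Fin n → Fin n → ℚ
  starWeight v y with y ≟ v | adj G v y
  ... | yes _ | _     = 1ℚ
  ... | no _  | true  = 0ℚ
  ... | no _  | false = - 1ℚ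

  star : Fin n → Graph n
  star v = thresholdGraph (starWeight v) 1ℚ

  starWeights⇒edge : ∀ {v x y} → x ≢ y → 1ℚ ≤ starWeight v x + starWeight v y → Edge G x y
  starWeights⇒edge {v} {x} {y} x≢y h with x ≟ v | y ≟ v | adj G v x in vx | adj G v y in vy
  ... | yes refl | yes refl | _     | _     = ⊥-elim (x≢y refl)
  ... | yes refl | no _     | _     | true  = vy
  ... | yes refl | no _     | _     | false = ⊥-elim (from-no (1ℚ ≤? 1ℚ + - 1ℚ) h)
  ... | no _     | yes refl | true  | _     = edge-sym G vx
  ... | no _     | yes refl | false | _     = ⊥-elim (from-no (1ℚ ≤? - 1ℚ + 1ℚ) h)
  ... | no _     | no _     | true  | true  = ⊥-elim (from-no (1ℚ ≤? 0ℚ + 0ℚ) h)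
  ... | no _     | no _     | true  | false = ⊥-elim (from-no (1ℚ ≤? 0ℚ + - 1ℚ) h)
  ... | no _     | no _     | false | true  = ⊥-elim (from-no (1ℚ ≤? - 1ℚ + 0ℚ) h)
  ... | no _     | no _     | false | false = ⊥-elim (from-no (1ℚ ≤? - 1ℚ + - 1ℚ) h)

  centre+neighbour-reaches-1 : ∀ {v y} → y ≢ v → Edge G v y → 1ℚ ≤ starWeight v v + starWeight v y
  centre+neighbour-reaches-1 {v} {y} y≢v e with v ≟ v | y ≟ v | adj G v y
  centre+neighbour-reaches-1 y≢v _  | no v≢v | _       | _    = ⊥-elim (v≢v refl)
  centre+neighbour-reaches-1 y≢v _  | yes _  | yes y≡v | _    = ⊥-elim (y≢v y≡v)
  centre+neighbour-reaches-1 y≢v _  | yes _  | no _    | true = ≤-refl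

  starCover : ThetaCover G n
  starCover = star , (λ v → thresholdGraph-isThreshold (starWeight v) 1ℚ) , subgraph , cover
    where
    subgraph : ∀ v → Subgraph (star v) G
    subgraph v x y e =
      starWeights⇒edge x≢y (Equivalence.to (thresholdGraph-represents (starWeight v) 1ℚ x y x≢y) e)
      where x≢y = edge⇒≢ (star v) e
    cover : ∀ x y → Edge G x y → ∃ λ v → Edge (star v) x y
    cover x y e = x , Equivalence.from (thresholdGraph-represents (starWeight x) 1ℚ x y x≢y)
                                       (centre+neighbour-reaches-1 (x≢y ∘ sym) e)
      where x≢y = edge⇒≢ G e

-- The least witness below b + 1 is the first i : Fin (suc b) at which ¬ P fails.
minimum : (P : ℕ → Set) → (∀ k → Dec (P k)) → ∀ {b} → P b → Σ ℕ (IsMin P)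
minimum P P? {b} pb
  with ¬∀⟶∃¬-smallest (suc b) (λ i → ¬ P (toℕ i)) (λ i → ¬? (P? (toℕ i)))
                      (λ none → none (fromℕ b) (subst P (sym (toℕ-fromℕ b)) pb))
... | i , ¬¬pi , below = toℕ i , decidable-stable (P? (toℕ i)) ¬¬pi , λ k pk → ℕP.≮⇒≥ λ k<i →
  below (fromℕ< k<i) (subst P (sym (trans (toℕ-inject (fromℕ< k<i)) (toℕ-fromℕ< k<i))) pk)

isMin-resp : ∀ {P Q : ℕ → Set} {m} → (∀ k → P k ⇔ Q k) → IsMin P m → IsMin Q m
isMin-resp P⇔Q (pm , minimal) =
  Equivalence.to (P⇔Q _) pm , λ k qk → minimal k (Equivalence.from (P⇔Q k) qk)

mainTheorem8 : ∀ {n} (G : Graph n) →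
    Σ ℕ λ m →
      IsMin (ThetaHatCover G) m × IsMin (RhoT G) m ×
      IsMin (RhoTHat (complement G)) m × IsMin (ThetaCover (complement G)) m
mainTheorem8 G with minimum (ThetaCover (complement G)) (λ _ → thetaCover? (complement G))
                         (Stars.starCover (complement G))
... | m , minΘ = m , isMin-resp Θ⇔Θ̂ minΘ , isMin-resp Θ⇔ρ minΘ , isMin-resp Θ⇔ρ̂ minΘ , minΘ
  where
  Θ⇔Θ̂ : ∀ k → ThetaCover (complement G) k ⇔ ThetaHatCover G k
  Θ⇔Θ̂ k = ⇔.trans (thetaCover⇔unionCover (complement G)) (⇔.sym (thetaHat⇔unionCover-complement G))
  Θ⇔ρ : ∀ k → ThetaCover (complement G) k ⇔ RhoT G k
  Θ⇔ρ k = ⇔.trans (Θ⇔Θ̂ k) (⇔.sym (rhoT⇔thetaHat G))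
  Θ⇔ρ̂ : ∀ k → ThetaCover (complement G) k ⇔ RhoTHat (complement G) k
  Θ⇔ρ̂ k = ⇔.trans (thetaCover⇔unionCover (complement G)) (⇔.sym (rhoTHat⇔unionCover (complement G)))
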